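{- Let $x,y$ be positive integers that are both powerful numbers and satisfy $\varphi(x)=\varphi(y)$. Then $x=y$.
   Context: A positive integer $n$ is a powerful number if no prime appears to exactly the first power in its prime factorisation (i.e. for every prime $p\mid n$ we have $p^2\mid n$). $\varphi$ denotes Euler's totient function. -}

module Defs where

open import Data.Nat using (ℕ; zero; suc; _+_; _*_; _^_)
open import Data.Nat.GCD using (gcd)
open import Data.Nat.Divisibility using (_∣_)
open import Data.Nat.Primality using (Prime)
open import Data.Bool using (if_then_else_)
open import Relation.Nullary.Decidable using (⌊_⌋)
open import Data.Nat using (_≟_)

coprimeCount : ℕ → ℕ → ℕ
coprimeCount zero    n = 0
coprimeCount (suc m) n =
  (if ⌊ gcd (suc m) n ≟ 1 ⌋ then 1 else 0) + coprimeCount m n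

-- Euler's totient: φ n = #{ k : 1 ≤ k ≤ n , gcd(k,n) = 1 }  (so φ 0 = 0).
φ : ℕ → ℕ
φ n = coprimeCount n n

Powerful : ℕ → Set
Powerful n = ∀ p → Prime p → p ∣ n → p ^ 2 ∣ n

module Submission where

-- Write a positive x ≠ 1 as x = P ^ (1 + a) * m where P is the largest prime
-- factor of x, so that every prime factor of m is below P.  Then
--     φ x = P ^ a * ((P - 1) * φ m),
-- and every prime factor of (P - 1) * φ m is below P.  If x is powerful then
-- a ≥ 1, so P is the largest prime factor of φ x, a is its exponent there and
-- (P - 1) * φ m is the remaining part: φ x determines P, a and φ m.  The
-- cofactor m is again powerful and smaller than x, so strong induction on x
-- finishes the proof.

open import Defs
open import Data.Bool using (Bool; true; false; if_then_else_; _∧_; not)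
open import Data.Bool.Properties using (∧-identityʳ; ∧-zeroʳ)
open import Data.Empty using (⊥-elim)
open import Data.List using ([]; _∷_)
open import Data.List.Relation.Unary.All using (_∷_)
open import Data.Nat
open import Data.Nat.Coprimality as Coprimality
  using (Coprime; coprime?; coprime-divisor; 1-coprimeTo)
open import Data.Nat.Divisibility
open import Data.Nat.GCD using (gcd)
open import Data.Nat.Induction using (<-rec)
open import Data.Nat.Primality
  using (Prime; prime?; prime⇒irreducible; prime⇒nonZero; prime⇒nonTrivial; euclidsLemma; ¬prime[1])
open import Data.Nat.Primality.Factorisation using (factorise)
open import Data.Nat.Properties
open import Data.Product using (_×_; _,_; Σ-syntax)
open import Data.Sum using (_⊎_; inj₁; inj₂)
open import Function.Bundles using (_⇔_; mk⇔)
open import Relation.Nullary using (¬_; does; yes; no)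
open import Relation.Nullary.Decidable using (isYes≗does; does-⇔; dec-true; dec-false; _×-dec_; ¬?)
open import Relation.Binary.PropositionalEquality
open import Algebra.Properties.CommutativeSemigroup +-commutativeSemigroup
  using () renaming (interchange to +-interchange)

private variable
  B n p : ℕ
  f g : ℕ → Bool

indicator : Bool → ℕ
indicator b = if b then 1 else 0

count : (ℕ → Bool) → ℕ → ℕ
count f zero    = 0
count f (suc m) = indicator (f (suc m)) + count f m

count-cong : (∀ k → f k ≡ g k) → ∀ m → count f m ≡ count g m
count-cong f≗g zero    = refl
count-cong f≗g (suc m) = cong₂ _+_ (cong indicator (f≗g (suc m))) (count-cong f≗g m)

count-split : ∀ (f h : ℕ → Bool) m →
  count f m ≡ count (λ k → f k ∧ h k) m + count (λ k → f k ∧ not (h k)) m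
count-split f h zero    = refl
count-split f h (suc m) =
  trans (cong₂ _+_ (indicator-split (f (suc m)) (h (suc m))) (count-split f h m))
        (+-interchange (indicator (f (suc m) ∧ h (suc m)))
                       (indicator (f (suc m) ∧ not (h (suc m))))
                       (count (λ k → f k ∧ h k) m) (count (λ k → f k ∧ not (h k)) m))
  where
  indicator-split : ∀ x y → indicator x ≡ indicator (x ∧ y) + indicator (x ∧ not y)
  indicator-split false y     = refl
  indicator-split true  false = refl
  indicator-split true  true  = refl

count-periodic : (∀ k → f (k + n) ≡ f k) → ∀ j → count f (j + n) ≡ count f j + count f n
count-periodic         f-per zero    = refl
count-periodic {f} {n} f-per (suc j) = begin
  indicator (f (suc j + n)) + count f (j + n)
    ≡⟨ cong₂ _+_ (cong indicator (f-per (suc j))) (count-periodic f-per j) ⟩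
  indicator (f (suc j)) + (count f j + count f n)
    ≡⟨ +-assoc (indicator (f (suc j))) (count f j) (count f n) ⟨
  count f (suc j) + count f n ∎
  where open ≡-Reasoning

count-periods : (∀ k → f (k + n) ≡ f k) → ∀ q → count f (q * n) ≡ q * count f n
count-periods         f-per zero    = refl
count-periods {f} {n} f-per (suc q) = begin
  count f (n + q * n)      ≡⟨ cong (count f) (+-comm n (q * n)) ⟩
  count f (q * n + n)      ≡⟨ count-periodic f-per (q * n) ⟩
  count f (q * n) + count f n ≡⟨ cong (_+ count f n) (count-periods f-per q) ⟩
  q * count f n + count f n ≡⟨ +-comm (q * count f n) (count f n) ⟩
  suc q * count f n ∎
  where open ≡-Reasoning

count-multiples : ∀ (f : ℕ → Bool) P .{{_ : NonZero P}} n →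
  count (λ k → f k ∧ does (P ∣? k)) (n * P) ≡ count (λ j → f (j * P)) n
count-multiples f P zero    = refl
count-multiples f P@(suc q) (suc n) =
  cong₂ _+_ top (trans (skip-non-multiples q ≤-refl) (count-multiples f P n))
  where
  f∧P∣ : ℕ → Bool
  f∧P∣ k = f k ∧ does (P ∣? k)
  top : indicator (f∧P∣ (suc n * P)) ≡ indicator (f (suc n * P))
  top rewrite dec-true (P ∣? (suc n * P)) (n∣m*n (suc n)) = cong indicator (∧-identityʳ _)
  not-multiple : ∀ i → suc i < P → ¬ P ∣ suc i + n * P
  not-multiple i 1+i<P P∣ =
    <⇒≱ 1+i<P (∣⇒≤ (∣m+n∣m⇒∣n (subst (P ∣_) (+-comm (suc i) (n * P)) P∣) (n∣m*n n)))
  skip-non-multiples : ∀ i → i < P → count f∧P∣ (i + n * P) ≡ count f∧P∣ (n * P)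
  skip-non-multiples zero    _     = refl
  skip-non-multiples (suc i) 1+i<P
    rewrite dec-false (P ∣? (suc i + n * P)) (not-multiple i 1+i<P)
          | ∧-zeroʳ (f (suc i + n * P)) = skip-non-multiples i (<⇒≤ 1+i<P)

coprime-*ˡ : ∀ {a b c} → Coprime a c → Coprime b c → Coprime (a * b) c
coprime-*ˡ a⊥c b⊥c (d∣ab , d∣c) =
  b⊥c (coprime-divisor (λ (e∣d , e∣a) → a⊥c (e∣a , ∣-trans e∣d d∣c)) d∣ab , d∣c)

coprime-*ʳ : ∀ {a b c} → Coprime a b → Coprime a c → Coprime a (b * c)
coprime-*ʳ a⊥b a⊥c = Coprimality.sym (coprime-*ˡ (Coprimality.sym a⊥b) (Coprimality.sym a⊥c))

coprime-∣ʳ : ∀ {a b c} → c ∣ b → Coprime a b → Coprime a c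
coprime-∣ʳ c∣b a⊥b (d∣a , d∣c) = a⊥b (d∣a , ∣-trans d∣c c∣b)

coprime-∣ˡ : ∀ {a b c} → c ∣ a → Coprime a b → Coprime c b
coprime-∣ˡ c∣a a⊥b = Coprimality.sym (coprime-∣ʳ c∣a (Coprimality.sym a⊥b))

prime-coprime : Prime p → ¬ p ∣ n → Coprime p n
prime-coprime p-prime p∤n (d∣p , d∣n) with prime⇒irreducible p-prime d∣p
... | inj₁ d≡1 = d≡1
... | inj₂ refl = ⊥-elim (p∤n d∣n)

coprimeTo : ℕ → ℕ → Bool
coprimeTo n k = does (coprime? k n)

φ-count : ∀ n → φ n ≡ count (coprimeTo n) n
φ-count n = coprimeCount-count n
  where
  coprimeCount-count : ∀ m → coprimeCount m n ≡ count (coprimeTo n) m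
  coprimeCount-count zero    = refl
  coprimeCount-count (suc m) =
    cong₂ _+_ (cong indicator (isYes≗does (gcd (suc m) n ≟ 1))) (coprimeCount-count m)

coprimeTo-⇔ : ∀ {k n k′ n′} → Coprime k n ⇔ Coprime k′ n′ → coprimeTo n k ≡ coprimeTo n′ k′
coprimeTo-⇔ k⊥n⇔k′⊥n′ = does-⇔ k⊥n⇔k′⊥n′ (coprime? _ _) (coprime? _ _)

coprimeTo-periodic : ∀ n k → coprimeTo n (k + n) ≡ coprimeTo n k
coprimeTo-periodic n k = coprimeTo-⇔ (mk⇔ drop-n add-n)
  where
  drop-n : Coprime (k + n) n → Coprime k n
  drop-n k+n⊥n (d∣k , d∣n) = k+n⊥n (∣m∣n⇒∣m+n d∣k d∣n , d∣n)
  add-n : Coprime k n → Coprime (k + n) n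
  add-n k⊥n {d} (d∣k+n , d∣n) = k⊥n (∣m+n∣m⇒∣n (subst (d ∣_) (+-comm k n) d∣k+n) d∣n , d∣n)

-- φ (p * n) = p * φ n whenever p ∣ n: coprimality to p * n and to n coincide.
φ-*-dividing : p ∣ n → φ (p * n) ≡ p * φ n
φ-*-dividing {p} {n} p∣n = begin
  φ (p * n)                       ≡⟨ φ-count (p * n) ⟩
  count (coprimeTo (p * n)) (p * n) ≡⟨ count-cong same-coprimality (p * n) ⟩
  count (coprimeTo n) (p * n)     ≡⟨ count-periods (coprimeTo-periodic n) p ⟩
  p * count (coprimeTo n) n       ≡⟨ cong (p *_) (φ-count n) ⟨
  p * φ n ∎
  where
  open ≡-Reasoning
  same-coprimality : ∀ k → coprimeTo (p * n) k ≡ coprimeTo n k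
  same-coprimality k = coprimeTo-⇔ (mk⇔ (coprime-∣ʳ (n∣m*n p)) add-p)
    where
    add-p : Coprime k n → Coprime k (p * n)
    add-p k⊥n = coprime-*ʳ (λ (d∣k , d∣p) → k⊥n (d∣k , ∣-trans d∣p p∣n)) k⊥n

-- Among 1, …, p * n the numbers
-- coprime to n number p * φ n; those that are multiples of p are j * p with j
-- coprime to n (φ n of them), and the rest are exactly those coprime to p * n.
φ-*-prime : Prime p → ¬ p ∣ n → φ (p * n) ≡ (p ∸ 1) * φ n
φ-*-prime {p} {n} p-prime p∤n =
  +-cancelˡ-≡ (φ n) _ _ (trans (sym p*φn≡φn+φpn) (cong (_* φ n) (sym (suc-pred p))))
  where
  open ≡-Reasoning
  instance
    _ = prime⇒nonZero p-prime
  multiples-coprime : ∀ j → coprimeTo n (j * p) ≡ coprimeTo n j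
  multiples-coprime j = coprimeTo-⇔ {j * p} {n} {j} {n}
    (mk⇔ (coprime-∣ˡ (m∣m*n p)) (λ j⊥n → coprime-*ˡ j⊥n (prime-coprime p-prime p∤n)))
  non-multiples-coprime : ∀ k → coprimeTo n k ∧ not (does (p ∣? k)) ≡ coprimeTo (p * n) k
  non-multiples-coprime k = does-⇔ (mk⇔ to from) (coprime? k n ×-dec ¬? (p ∣? k)) (coprime? k (p * n))
    where
    to : Coprime k n × ¬ p ∣ k → Coprime k (p * n)
    to (k⊥n , p∤k) = coprime-*ʳ (Coprimality.sym (prime-coprime p-prime p∤k)) k⊥n
    from : Coprime k (p * n) → Coprime k n × ¬ p ∣ k
    from k⊥pn = coprime-∣ʳ (n∣m*n p) k⊥pn
              , (λ p∣k → ¬prime[1] (subst Prime (k⊥pn (p∣k , m∣m*n n)) p-prime))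
  p*φn≡φn+φpn : p * φ n ≡ φ n + φ (p * n)
  p*φn≡φn+φpn = begin
    p * φ n
      ≡⟨ cong (p *_) (φ-count n) ⟩
    p * count (coprimeTo n) n
      ≡⟨ count-periods (coprimeTo-periodic n) p ⟨
    count (coprimeTo n) (p * n)
      ≡⟨ count-split (coprimeTo n) (λ k → does (p ∣? k)) (p * n) ⟩
    count (λ k → coprimeTo n k ∧ does (p ∣? k)) (p * n)
      + count (λ k → coprimeTo n k ∧ not (does (p ∣? k))) (p * n)
      ≡⟨ cong₂ _+_ multiples-part (count-cong non-multiples-coprime (p * n)) ⟩
    φ n + count (coprimeTo (p * n)) (p * n)
      ≡⟨ cong (φ n +_) (φ-count (p * n)) ⟨
    φ n + φ (p * n) ∎
    where
    multiples-part : count (λ k → coprimeTo n k ∧ does (p ∣? k)) (p * n) ≡ φ n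
    multiples-part = begin
      count (λ k → coprimeTo n k ∧ does (p ∣? k)) (p * n)
        ≡⟨ cong (count _) (*-comm p n) ⟩
      count (λ k → coprimeTo n k ∧ does (p ∣? k)) (n * p)
        ≡⟨ count-multiples (coprimeTo n) p n ⟩
      count (λ j → coprimeTo n (j * p)) n
        ≡⟨ count-cong multiples-coprime n ⟩
      count (coprimeTo n) n
        ≡⟨ φ-count n ⟨
      φ n ∎

φ-prime-power : ∀ {P m} → Prime P → ¬ P ∣ m → ∀ a → φ (P ^ suc a * m) ≡ P ^ a * ((P ∸ 1) * φ m)
φ-prime-power {P} {m} P-prime P∤m zero = begin
  φ (P * 1 * m)     ≡⟨ cong (λ z → φ (z * m)) (*-identityʳ P) ⟩
  φ (P * m)         ≡⟨ φ-*-prime P-prime P∤m ⟩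
  (P ∸ 1) * φ m     ≡⟨ *-identityˡ _ ⟨
  1 * ((P ∸ 1) * φ m) ∎
  where open ≡-Reasoning
φ-prime-power {P} {m} P-prime P∤m (suc a) = begin
  φ (P * P ^ suc a * m)           ≡⟨ cong φ (*-assoc P (P ^ suc a) m) ⟩
  φ (P * (P ^ suc a * m))         ≡⟨ φ-*-dividing {P} (∣-trans (m∣m*n (P ^ a)) (m∣m*n m)) ⟩
  P * φ (P ^ suc a * m)           ≡⟨ cong (P *_) (φ-prime-power P-prime P∤m a) ⟩
  P * (P ^ a * ((P ∸ 1) * φ m))   ≡⟨ *-assoc P (P ^ a) _ ⟨
  P * P ^ a * ((P ∸ 1) * φ m) ∎
  where open ≡-Reasoning

Below : ℕ → ℕ → Set
Below B n = ∀ p → Prime p → p ∣ n → p < B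

prime>1 : Prime p → 1 < p
prime>1 {p} p-prime = nonTrivial⇒n>1 p {{prime⇒nonTrivial p-prime}}

below-1 : Below B 1
below-1 p p-prime p∣1 = ⊥-elim (¬prime[1] (subst Prime (∣1⇒≡1 p∣1) p-prime))

below-mono : ∀ {B B′} → B ≤ B′ → Below B n → Below B′ n
below-mono B≤B′ below p p-prime p∣n = <-≤-trans (below p p-prime p∣n) B≤B′

below-∣ : ∀ {d} → d ∣ n → Below B n → Below B d
below-∣ d∣n below p p-prime p∣d = below p p-prime (∣-trans p∣d d∣n)

below-suc : Below (suc B) n → (Prime B → ¬ B ∣ n) → Below B n
below-suc below B∤n p p-prime p∣n with m≤n⇒m<n∨m≡n (s≤s⁻¹ (below p p-prime p∣n))
... | inj₁ p<B  = p<B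
... | inj₂ refl = ⊥-elim (B∤n p-prime p∣n)

below-* : ∀ {u v} → Below B u → Below B v → Below B (u * v)
below-* {u = u} below-u below-v p p-prime p∣uv with euclidsLemma u _ p-prime p∣uv
... | inj₁ p∣u = below-u p p-prime p∣u
... | inj₂ p∣v = below-v p p-prime p∣v

below-^ : ∀ {u} → Below B u → ∀ a → Below B (u ^ a)
below-^ below zero    = below-1
below-^ below (suc a) = below-* below (below-^ below a)

below-self : 0 < n → Below (suc n) n
below-self 0<n p _ p∣n = s≤s (∣⇒≤ {{>-nonZero 0<n}} p∣n)

below-pred : ∀ {P} → Prime P → Below P (P ∸ 1)
below-pred {P} P-prime p _ p∣P-1 =
  ≤-<-trans (∣⇒≤ {{>-nonZero (m<n⇒0<n∸m (prime>1 P-prime))}} p∣P-1) pred[P]<P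
  where
  pred[P]<P : P ∸ 1 < P
  pred[P]<P = ≤-reflexive (suc-pred P {{prime⇒nonZero P-prime}})

below⇒∤ : ∀ {P} → Prime P → Below P n → ¬ P ∣ n
below⇒∤ P-prime below P∣n = <-irrefl refl (below _ P-prime P∣n)

below-0⇒≡1 : ∀ n .{{_ : NonZero n}} → Below 0 n → n ≡ 1
below-0⇒≡1 n below with factorise n
... | record { factors = [] ; isFactorisation = n≡1 } = n≡1
... | record { factors = p ∷ ps ; isFactorisation = n≡p*ps ; factorsPrime = p-prime ∷ _ } =
  ⊥-elim (n≮0 (below p p-prime (subst (p ∣_) (sym n≡p*ps) (m∣m*n _))))

largestPrimeFactor : ∀ B n .{{_ : NonZero n}} → Below B n →
  n ≡ 1 ⊎ Σ[ P ∈ ℕ ] Prime P × P ∣ n × Below (suc P) n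
largestPrimeFactor zero    n below = inj₁ (below-0⇒≡1 n below)
largestPrimeFactor (suc B) n below with prime? B ×-dec B ∣? n
... | yes (B-prime , B∣n) = inj₂ (B , B-prime , B∣n , below)
... | no ¬B-prime-factor  =
  largestPrimeFactor B n (below-suc below (λ B-prime B∣n → ¬B-prime-factor (B-prime , B∣n)))

factorOut : ∀ {P} → Prime P → ∀ x → 0 < x → P ∣ x →
  Σ[ a ∈ ℕ ] Σ[ m ∈ ℕ ] x ≡ P ^ suc a * m × ¬ P ∣ m
factorOut {P} P-prime = <-rec Goal step
  where
  Goal : ℕ → Set
  Goal x = 0 < x → P ∣ x → Σ[ a ∈ ℕ ] Σ[ m ∈ ℕ ] x ≡ P ^ suc a * m × ¬ P ∣ m
  step : ∀ x → (∀ {y} → y < x → Goal y) → Goal x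
  step x rec 0<x (divides q x≡qP) with P ∣? q
  ... | no P∤q = 0 , q , trans x≡qP (trans (*-comm q P) (cong (_* q) (sym (*-identityʳ P)))) , P∤q
  ... | yes P∣q with rec q<x 0<q P∣q
    where
    0<q : 0 < q
    0<q = n≢0⇒n>0 (λ { refl → <⇒≢ 0<x (sym x≡qP) })
    q<x : q < x
    q<x = subst (q <_) (sym x≡qP) (m<m*n q P {{>-nonZero 0<q}} (prime>1 P-prime))
  ... | a , m , q≡Pᵃ⁺¹m , P∤m = suc a , m , x≡Pᵃ⁺²m , P∤m
    where
    open ≡-Reasoning
    x≡Pᵃ⁺²m : x ≡ P ^ suc (suc a) * m
    x≡Pᵃ⁺²m = begin
      x                 ≡⟨ x≡qP ⟩
      q * P             ≡⟨ cong (_* P) q≡Pᵃ⁺¹m ⟩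
      P ^ suc a * m * P ≡⟨ *-comm (P ^ suc a * m) P ⟩
      P * (P ^ suc a * m) ≡⟨ *-assoc P (P ^ suc a) m ⟨
      P ^ suc (suc a) * m ∎

record TopPrimePower (x : ℕ) : Set where
  field
    P a m      : ℕ
    P-prime    : Prime P
    x≡Pᵃ⁺¹m    : x ≡ P ^ suc a * m
    m-below    : Below P m

  P∤m : ¬ P ∣ m
  P∤m = below⇒∤ P-prime m-below

  P∣x : P ∣ x
  P∣x = subst (P ∣_) (sym x≡Pᵃ⁺¹m) (∣-trans (m∣m*n (P ^ a)) (m∣m*n m))

  m∣x : m ∣ x
  m∣x = subst (m ∣_) (sym x≡Pᵃ⁺¹m) (n∣m*n (P ^ suc a))

  0<m : 0 < x → 0 < m
  0<m 0<x = n≢0⇒n>0 λ m≡0 →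
    <⇒≢ 0<x (sym (trans x≡Pᵃ⁺¹m (trans (cong (P ^ suc a *_) m≡0) (*-zeroʳ (P ^ suc a)))))

  m<x : 0 < x → m < x
  m<x 0<x = subst (m <_) (sym (trans x≡Pᵃ⁺¹m (*-comm (P ^ suc a) m)))
                  (m<m*n m (P ^ suc a) {{>-nonZero (0<m 0<x)}} 1<Pᵃ⁺¹)
    where
    1<Pᵃ⁺¹ : 1 < P ^ suc a
    1<Pᵃ⁺¹ = ^-monoʳ-< P (prime>1 P-prime) (z<s {a})

  φ-factorisation : φ x ≡ P ^ a * ((P ∸ 1) * φ m)
  φ-factorisation = trans (cong φ x≡Pᵃ⁺¹m) (φ-prime-power P-prime P∤m a)

module T = TopPrimePower

topPrimePower : ∀ x → 0 < x → x ≡ 1 ⊎ TopPrimePower x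
topPrimePower x 0<x with largestPrimeFactor (suc x) x {{>-nonZero 0<x}} (below-self 0<x)
... | inj₁ x≡1 = inj₁ x≡1
... | inj₂ (P , P-prime , P∣x , x-below) with factorOut P-prime x 0<x P∣x
... | a , m , x≡Pᵃ⁺¹m , P∤m = inj₂ (record
  { P = P ; a = a ; m = m ; P-prime = P-prime ; x≡Pᵃ⁺¹m = x≡Pᵃ⁺¹m ; m-below = m-below })
  where
  m∣x : m ∣ x
  m∣x = subst (m ∣_) (sym x≡Pᵃ⁺¹m) (n∣m*n (P ^ suc a))
  m-below : Below P m
  m-below = below-suc (below-∣ m∣x x-below) (λ _ → P∤m)

module _ {x} (t : TopPrimePower x) where
  open TopPrimePower t

  φ-below-top : Below P (φ m) → Below (suc P) (φ x)
  φ-below-top φm-below = subst (Below (suc P)) (sym φ-factorisation)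
    (below-* (below-^ (below-self (<-trans z<s (prime>1 P-prime))) a)
             (below-mono (n≤1+n P) (below-* (below-pred P-prime) φm-below)))

φ-below : ∀ n → 0 < n → Below B n → Below B (φ n)
φ-below n = <-rec Goal step n
  where
  Goal : ℕ → Set
  Goal n = ∀ {B} → 0 < n → Below B n → Below B (φ n)
  step : ∀ n → (∀ {y} → y < n → Goal y) → Goal n
  step n rec 0<n n-below with topPrimePower n 0<n
  ... | inj₁ refl = below-1
  ... | inj₂ t    = below-mono (n-below P P-prime P∣x)
                      (φ-below-top t (rec (m<x 0<n) (0<m 0<n) m-below))
    where open TopPrimePower t

coprime-^ʳ : ∀ {a b} → Coprime a b → ∀ k → Coprime a (b ^ k)
coprime-^ʳ {a} a⊥b zero    = Coprimality.sym (1-coprimeTo a)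
coprime-^ʳ     a⊥b (suc k) = coprime-*ʳ a⊥b (coprime-^ʳ a⊥b k)

coprime-^ˡ : ∀ {a b} → Coprime a b → ∀ k → Coprime (a ^ k) b
coprime-^ˡ a⊥b k = Coprimality.sym (coprime-^ʳ (Coprimality.sym a⊥b) k)

P²∣Pᵃ⁺¹m⇒P∣Pᵃ : ∀ {P m} a → Prime P → ¬ P ∣ m → P ^ 2 ∣ P ^ suc a * m → P ∣ P ^ a
P²∣Pᵃ⁺¹m⇒P∣Pᵃ {P} {m} zero P-prime P∤m P²∣Pm =
  ⊥-elim (P∤m (*-cancelˡ-∣ P {{prime⇒nonZero P-prime}}
    (subst₂ _∣_ (cong (P *_) (*-identityʳ P)) (cong (_* m) (*-identityʳ P)) P²∣Pm)))
P²∣Pᵃ⁺¹m⇒P∣Pᵃ {P} (suc a) _ _ _ = m∣m*n (P ^ a)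

module _ {x} (x-powerful : Powerful x) (t : TopPrimePower x) where
  open TopPrimePower t

  -- The largest prime factor occurs at least squared, so it survives in φ x.
  top-prime-∣-φ : P ∣ φ x
  top-prime-∣-φ = subst (P ∣_) (sym φ-factorisation) (∣-trans P∣Pᵃ (m∣m*n _))
    where
    P∣Pᵃ : P ∣ P ^ a
    P∣Pᵃ = P²∣Pᵃ⁺¹m⇒P∣Pᵃ a P-prime P∤m (subst (P ^ 2 ∣_) x≡Pᵃ⁺¹m (x-powerful P P-prime P∣x))

  φ≢1 : φ x ≢ 1
  φ≢1 φx≡1 = ¬prime[1] (subst Prime (∣1⇒≡1 (subst (P ∣_) φx≡1 top-prime-∣-φ)) P-prime)

  -- Removing the top prime power keeps the number powerful: for p ∣ m we have
  -- p < P, so p ^ 2 is coprime to P ^ (1 + a) and must divide m.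
  cofactor-powerful : Powerful m
  cofactor-powerful p p-prime p∣m =
    coprime-divisor p²⊥Pᵃ⁺¹ (subst (p ^ 2 ∣_) x≡Pᵃ⁺¹m (x-powerful p p-prime (∣-trans p∣m m∣x)))
    where
    p⊥P : Coprime p P
    p⊥P = Coprimality.sym (prime-coprime P-prime (>⇒∤ {{prime⇒nonZero p-prime}} (m-below p p-prime p∣m)))
    p²⊥Pᵃ⁺¹ : Coprime (p ^ 2) (P ^ suc a)
    p²⊥Pᵃ⁺¹ = coprime-^ˡ (coprime-^ʳ p⊥P (suc a)) 2

cancel-prime-power : ∀ {P} .{{_ : NonZero P}} i j {U V} → ¬ P ∣ U → ¬ P ∣ V →
  P ^ i * U ≡ P ^ j * V → i ≡ j × U ≡ V
cancel-prime-power         zero    zero    _   _   U≡V =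
  refl , trans (sym (*-identityˡ _)) (trans U≡V (*-identityˡ _))
cancel-prime-power {P}     zero    (suc j) P∤U _   U≡V =
  ⊥-elim (P∤U (subst (P ∣_) (trans (sym U≡V) (*-identityˡ _)) (∣-trans (m∣m*n (P ^ j)) (m∣m*n _))))
cancel-prime-power {P}     (suc i) zero    _   P∤V U≡V =
  ⊥-elim (P∤V (subst (P ∣_) (trans U≡V (*-identityˡ _)) (∣-trans (m∣m*n (P ^ i)) (m∣m*n _))))
cancel-prime-power {P} (suc i) (suc j) {U} {V} P∤U P∤V PU≡PV =
  let i≡j , U≡V = cancel-prime-power i j P∤U P∤V
                    (*-cancelˡ-≡ _ _ P (trans (sym (*-assoc P (P ^ i) U)) (trans PU≡PV (*-assoc P (P ^ j) V))))
  in cong suc i≡j , U≡V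

module _ {x} (t : TopPrimePower x) where
  open TopPrimePower t

  P∤φ-free-part : 0 < x → ¬ P ∣ (P ∸ 1) * φ m
  P∤φ-free-part 0<x = below⇒∤ P-prime (below-* (below-pred P-prime) (φ-below m (0<m 0<x) m-below))

cancel-φ-factorisations : ∀ {P Q a b u v} → P ≡ Q → Prime P →
  ¬ P ∣ (P ∸ 1) * u → ¬ Q ∣ (Q ∸ 1) * v →
  P ^ a * ((P ∸ 1) * u) ≡ Q ^ b * ((Q ∸ 1) * v) → a ≡ b × u ≡ v
cancel-φ-factorisations {P} {a = a} {b} refl P-prime P∤U P∤V eq =
  let a≡b , U≡V = cancel-prime-power {{prime⇒nonZero P-prime}} a b P∤U P∤V eq
  in a≡b , *-cancelˡ-≡ _ _ (P ∸ 1) {{>-nonZero (m<n⇒0<n∸m (prime>1 P-prime))}} U≡V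

-- For powerful x, the top prime of x divides φ x; for any y the prime
-- factors of φ y are at most the top prime of y.  So φ x = φ y compares them.
top-prime-≤ : ∀ {x y} → Powerful x → 0 < y → (tx : TopPrimePower x) (ty : TopPrimePower y) →
  φ x ≡ φ y → T.P tx ≤ T.P ty
top-prime-≤ x-powerful 0<y tx ty φx≡φy =
  s≤s⁻¹ (φ-below-top ty (φ-below _ (T.0<m ty 0<y) (T.m-below ty)) (T.P tx) (T.P-prime tx)
           (subst (T.P tx ∣_) φx≡φy (top-prime-∣-φ x-powerful tx)))

φ-determines-top : ∀ {x y} → Powerful x → Powerful y → 0 < x → 0 < y →
  (tx : TopPrimePower x) (ty : TopPrimePower y) → φ x ≡ φ y →
  T.P tx ≡ T.P ty × T.a tx ≡ T.a ty × φ (T.m tx) ≡ φ (T.m ty)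
φ-determines-top x-powerful y-powerful 0<x 0<y tx ty φx≡φy =
  P≡Q , cancel-φ-factorisations P≡Q (T.P-prime tx) (P∤φ-free-part tx 0<x) (P∤φ-free-part ty 0<y)
          (trans (sym (T.φ-factorisation tx)) (trans φx≡φy (T.φ-factorisation ty)))
  where
  P≡Q : T.P tx ≡ T.P ty
  P≡Q = ≤-antisym (top-prime-≤ x-powerful 0<y tx ty φx≡φy) (top-prime-≤ y-powerful 0<x ty tx (sym φx≡φy))

top-prime-power-≡ : ∀ {x y} (tx : TopPrimePower x) (ty : TopPrimePower y) →
  T.P tx ≡ T.P ty → T.a tx ≡ T.a ty → T.m tx ≡ T.m ty → x ≡ y
top-prime-power-≡ tx ty P≡Q a≡b m≡m′ =
  trans (T.x≡Pᵃ⁺¹m tx) (trans (cong₂ _*_ (cong₂ (λ Q b → Q ^ suc b) P≡Q a≡b) m≡m′) (sym (T.x≡Pᵃ⁺¹m ty)))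

proposition2 : ∀ (x y : ℕ) → 0 < x → 0 < y → Powerful x → Powerful y →
    φ x ≡ φ y → x ≡ y
proposition2 = <-rec Goal step
  where
  Goal : ℕ → Set
  Goal x = ∀ y → 0 < x → 0 < y → Powerful x → Powerful y → φ x ≡ φ y → x ≡ y
  step : ∀ x → (∀ {x′} → x′ < x → Goal x′) → Goal x
  step x rec y 0<x 0<y x-powerful y-powerful φx≡φy with topPrimePower x 0<x | topPrimePower y 0<y
  ... | inj₁ refl | inj₁ refl = refl
  ... | inj₁ refl | inj₂ ty   = ⊥-elim (φ≢1 y-powerful ty (sym φx≡φy))
  ... | inj₂ tx   | inj₁ refl = ⊥-elim (φ≢1 x-powerful tx φx≡φy)
  ... | inj₂ tx   | inj₂ ty   =
    let P≡Q , a≡b , φm≡φm′ = φ-determines-top x-powerful y-powerful 0<x 0<y tx ty φx≡φy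
        m≡m′ = rec (T.m<x tx 0<x) (T.m ty) (T.0<m tx 0<x) (T.0<m ty 0<y)
                   (cofactor-powerful x-powerful tx) (cofactor-powerful y-powerful ty) φm≡φm′
    in top-prime-power-≡ tx ty P≡Q a≡b m≡m′
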